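{- For $n\ge 5$, let $D_n$ be the graph with vertex set $\{v_1,\dots,v_n\}$ and edge set $\{v_iv_j : i,j\in\{1,\dots,n-4\},\ i\ne j\}\cup\{v_{n-3}v_i : 1\le i\le n-5\}\cup\{v_{n-2}v_i : 2\le i\le n-4\}\cup\{v_{n-2}v_{n-3},\ v_{n-1}v_{n-3},\ v_nv_{n-2}\}$. Then $\chi_s(D_n)=n-2$.
   Context: A star coloring of a graph $G$ is a proper vertex-coloring such that no path on four vertices (as a subgraph) is colored with only two colors; $\chi_s(G)$ is the minimum number of colors in a star coloring of $G$. -}

module Defs where

open import Data.Nat using (ℕ; suc; _∸_; _≤_; _<_)
open import Data.Fin using (Fin; toℕ)
open import Data.Product using (_×_; ∃; ∃-syntax; Σ-syntax)
open import Data.Sum using (_⊎_)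
open import Relation.Binary.PropositionalEquality using (_≡_; _≢_)
open import Relation.Nullary using (¬_)

Graph : ℕ → Set₁
Graph n = Fin n → Fin n → Set

Proper : ∀ {n k} → Graph n → (Fin n → Fin k) → Set
Proper G col = ∀ u v → G u v → col u ≢ col v

IsP4 : ∀ {n} → Graph n → Fin n → Fin n → Fin n → Fin n → Set
IsP4 G a b c d =
  (a ≢ b × a ≢ c × a ≢ d × b ≢ c × b ≢ d × c ≢ d)
  × G a b × G b c × G c d

TwoColoured : ∀ {n k} → (Fin n → Fin k) → Fin n → Fin n → Fin n → Fin n → Set
TwoColoured col a b c d = ∃[ x ] ∃[ y ]
  ((col a ≡ x ⊎ col a ≡ y) × (col b ≡ x ⊎ col b ≡ y)
   × (col c ≡ x ⊎ col c ≡ y) × (col d ≡ x ⊎ col d ≡ y))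

StarColoring : ∀ {n} → Graph n → (k : ℕ) → (Fin n → Fin k) → Set
StarColoring G k col =
  Proper G col × (∀ a b c d → IsP4 G a b c d → ¬ TwoColoured col a b c d)

StarChromaticNumber≡ : ∀ {n} → Graph n → ℕ → Set
StarChromaticNumber≡ {n} G m =
  (∃[ col ] StarColoring G m col)
  × (∀ k → k < m → (col : Fin n → Fin k) → ¬ StarColoring G k col)

-- Edge generators of D_n on 1-based indices i, j ∈ {1..n}.
DBase : ℕ → ℕ → ℕ → Set
DBase n i j =
    (i ≢ j × 1 ≤ i × i ≤ n ∸ 4 × 1 ≤ j × j ≤ n ∸ 4)
  ⊎ (i ≡ n ∸ 3 × 1 ≤ j × j ≤ n ∸ 5)
  ⊎ (i ≡ n ∸ 2 × 2 ≤ j × j ≤ n ∸ 4)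
  ⊎ (i ≡ n ∸ 2 × j ≡ n ∸ 3)
  ⊎ (i ≡ n ∸ 1 × j ≡ n ∸ 3)
  ⊎ (i ≡ n × j ≡ n ∸ 2)

-- D_n: vertex v : Fin n is v_{toℕ v + 1}; edges are undirected.
D : (n : ℕ) → Graph n
D n u v = DBase n (suc (toℕ u)) (suc (toℕ v)) ⊎ DBase n (suc (toℕ v)) (suc (toℕ u))

-- Upper bound: colour the clique v₁ … v_{n-4} together with v_{n-3} and v_{n-2}
-- injectively, give v_{n-1} the colour of v_{n-2} and v_n the colour of v₁. The
-- only colour classes with two vertices are {v_{n-2}, v_{n-1}} and {v₁, v_n}, and
-- these four vertices span the single edge v_{n-2}v_n, so no path on four
-- vertices alternates between two colours.
--
-- Lower bound: the hubs v_{n-3} and v_{n-2} are adjacent to each other and to all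
-- of the clique except v_{n-4} and v₁ respectively. If a hub shares its colour
-- with its missing clique vertex, alternating paths force the pendant vertex at
-- that hub and the other hub to avoid all clique colours and each other;
-- otherwise the two hubs avoid them. Either way n − 2 colours occur. For n = 5
-- the clique is a single isolated vertex and the path v₄v₂v₃v₅ alone needs three
-- colours.

{-# OPTIONS --safe #-}
module Submission where

open import Defs
open import Data.Nat using (ℕ; zero; suc; _+_; _∸_; _≤_; _<_; z≤n; s≤s; _≟_)
open import Data.Nat.Properties
  using (≤-pred; +-cancelʳ-≡; ≤∧≢⇒<; <⇒≢; <⇒≱; <-≤-trans; m≤n+m; +-monoˡ-<; m+n≮n; n≢0⇒n>0; suc-injective)
open import Data.Fin as F using (Fin; toℕ; fromℕ; fromℕ<; #_)
open import Data.Fin.Properties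
  using (toℕ-injective; toℕ-fromℕ; toℕ-fromℕ<; fromℕ<-injective; toℕ<n; injective⇒≤)
  renaming (_≟_ to _≟ᶠ_)
open import Data.Product using (_×_; _,_; proj₁; ∃-syntax)
open import Data.Sum using (_⊎_; inj₁; inj₂)
open import Data.Empty using (⊥; ⊥-elim)
open import Function using (_∘_)
open import Function.Definitions using (Injective)
open import Relation.Nullary using (¬_; yes; no)
open import Relation.Binary.Definitions using (Symmetric)
open import Relation.Binary.PropositionalEquality
  using (_≡_; _≢_; refl; sym; trans; cong; subst; ≢-sym)

twoValued⇒alternating : ∀ {A : Set} {a b c d x y : A} → a ≢ b → b ≢ c → c ≢ d →
  (a ≡ x ⊎ a ≡ y) → (b ≡ x ⊎ b ≡ y) → (c ≡ x ⊎ c ≡ y) → (d ≡ x ⊎ d ≡ y) →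
  a ≡ c × b ≡ d
twoValued⇒alternating a≢b _ _ (inj₁ refl) (inj₁ refl) _ _ = ⊥-elim (a≢b refl)
twoValued⇒alternating a≢b _ _ (inj₂ refl) (inj₂ refl) _ _ = ⊥-elim (a≢b refl)
twoValued⇒alternating _ b≢c _ _ (inj₁ refl) (inj₁ refl) _ = ⊥-elim (b≢c refl)
twoValued⇒alternating _ b≢c _ _ (inj₂ refl) (inj₂ refl) _ = ⊥-elim (b≢c refl)
twoValued⇒alternating _ _ c≢d _ _ (inj₁ refl) (inj₁ refl) = ⊥-elim (c≢d refl)
twoValued⇒alternating _ _ c≢d _ _ (inj₂ refl) (inj₂ refl) = ⊥-elim (c≢d refl)
twoValued⇒alternating _ _ _ (inj₁ refl) (inj₂ refl) (inj₁ refl) (inj₂ refl) = refl , refl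
twoValued⇒alternating _ _ _ (inj₂ refl) (inj₁ refl) (inj₂ refl) (inj₁ refl) = refl , refl

module _ {n k : ℕ} {G : Graph n} {col : Fin n → Fin k} where

  star⇒¬alternatingP4 : StarColoring G k col → ∀ {p q r s} →
    G p q → G q r → G r s → p ≢ r → q ≢ s → col p ≡ col r → col q ≡ col s → ⊥
  star⇒¬alternatingP4 (proper , noTwoColouredP4) {p} {q} {r} {s} pq qr rs p≢r q≢s pr qs =
    noTwoColouredP4 p q r s
      ((adjacent⇒≢ pq , p≢r , p≢s , adjacent⇒≢ qr , q≢s , adjacent⇒≢ rs) , pq , qr , rs)
      (col p , col q , inj₁ refl , inj₂ refl , inj₁ (sym pr) , inj₂ (sym qs))
    where
    adjacent⇒≢ : ∀ {u v} → G u v → u ≢ v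
    adjacent⇒≢ uv refl = proper _ _ uv refl
    p≢s : p ≢ s
    p≢s refl = proper q r qr (trans qs pr)

  proper∧matching⇒star : Proper G col → (S : Fin n → Set) →
    (∀ u v → u ≢ v → col u ≡ col v → S u × S v) →
    (∀ {u v w} → S u → S v → S w → G u v → G v w → u ≡ w) →
    StarColoring G k col
  proper∧matching⇒star proper S monochromatic⇒S matching = proper , noTwoColouredP4
    where
    noTwoColouredP4 : ∀ p q r s → IsP4 G p q r s → ¬ TwoColoured col p q r s
    noTwoColouredP4 p q r s ((_ , p≢r , _ , _ , q≢s , _) , pq , qr , rs) (_ , _ , cp , cq , cr , cs)
      with twoValued⇒alternating (proper _ _ pq) (proper _ _ qr) (proper _ _ rs) cp cq cr cs
    ... | pr , qs with monochromatic⇒S p r p≢r pr | monochromatic⇒S q s q≢s qs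
    ... | Sp , Sr | Sq , _ = p≢r (matching Sp Sq Sr pq qr)

  cliquePlusTwo⇒colours : Proper G col → ∀ {m} (clique : Fin m → Fin n) →
    (∀ {s t} → s ≢ t → G (clique s) (clique t)) →
    ∀ {x y} → (∀ t → col x ≢ col (clique t)) → (∀ t → col y ≢ col (clique t)) →
    col x ≢ col y → 2 + m ≤ k
  cliquePlusTwo⇒colours proper {m} clique clique-adj {x} {y} x∉ y∉ x≢y =
    injective⇒≤ {f = col ∘ vertices} distinctColours
    where
    vertices : Fin (2 + m) → Fin n
    vertices F.zero = x
    vertices (F.suc F.zero) = y
    vertices (F.suc (F.suc t)) = clique t
    distinctColours : Injective _≡_ _≡_ (col ∘ vertices)
    distinctColours {F.zero} {F.zero} _ = refl
    distinctColours {F.zero} {F.suc F.zero} e = ⊥-elim (x≢y e)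
    distinctColours {F.zero} {F.suc (F.suc t)} e = ⊥-elim (x∉ t e)
    distinctColours {F.suc F.zero} {F.zero} e = ⊥-elim (x≢y (sym e))
    distinctColours {F.suc F.zero} {F.suc F.zero} _ = refl
    distinctColours {F.suc F.zero} {F.suc (F.suc t)} e = ⊥-elim (y∉ t e)
    distinctColours {F.suc (F.suc s)} {F.zero} e = ⊥-elim (x∉ s (sym e))
    distinctColours {F.suc (F.suc s)} {F.suc F.zero} e = ⊥-elim (y∉ s (sym e))
    distinctColours {F.suc (F.suc s)} {F.suc (F.suc t)} e with s ≟ᶠ t
    ... | yes refl = refl
    ... | no s≢t = ⊥-elim (proper _ _ (clique-adj s≢t) e)

  singletonClique : ∀ v {s t : Fin 1} → s ≢ t → G v v
  singletonClique _ {F.zero} {F.zero} s≢t = ⊥-elim (s≢t refl)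

  star∧P4⇒3≤colours : StarColoring G k col → ∀ {p q r s} →
    G p q → G q r → G r s → p ≢ r → q ≢ s → 3 ≤ k
  star∧P4⇒3≤colours star@(proper , _) {p} {q} {r} {s} pq qr rs p≢r q≢s
    with col p ≟ᶠ col r | col q ≟ᶠ col s
  ... | yes pr | yes qs = ⊥-elim (star⇒¬alternatingP4 star pq qr rs p≢r q≢s pr qs)
  ... | no p≉r | _ =
    cliquePlusTwo⇒colours proper (λ _ → q) (singletonClique q) (λ _ → proper p q pq)
      (λ _ e → proper q r qr (sym e)) p≉r
  ... | _ | no q≉s =
    cliquePlusTwo⇒colours proper (λ _ → r) (singletonClique r) (λ _ → proper q r qr)
      (λ _ e → proper r s rs (sym e)) q≉s

record TwoHubs {n : ℕ} (G : Graph n) (m : ℕ) : Set where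
  field
    clique                    : Fin m → Fin n
    clique-adj                : ∀ {s t} → s ≢ t → G (clique s) (clique t)
    hubˡ hubʳ leafˡ leafʳ     : Fin n
    missˡ missʳ               : Fin m
    missˡ≢missʳ               : missˡ ≢ missʳ
    hubˡ-adj                  : ∀ {t} → t ≢ missˡ → G hubˡ (clique t)
    hubʳ-adj                  : ∀ {t} → t ≢ missʳ → G hubʳ (clique t)
    hubˡ-hubʳ                 : G hubˡ hubʳ
    leafˡ-adj                 : G leafˡ hubˡ
    leafʳ-adj                 : G leafʳ hubʳ
    leafˡ≢hubʳ                : leafˡ ≢ hubʳ
    leafʳ≢hubˡ                : leafʳ ≢ hubˡ
    hubˡ∉clique               : ∀ t → hubˡ ≢ clique t
    hubʳ∉clique               : ∀ t → hubʳ ≢ clique t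
    leafˡ∉clique              : ∀ t → leafˡ ≢ clique t
    leafʳ∉clique              : ∀ t → leafʳ ≢ clique t

mirror : ∀ {n m} {G : Graph n} → Symmetric G → TwoHubs G m → TwoHubs G m
mirror G-sym H = record
  { clique = clique ; clique-adj = clique-adj
  ; hubˡ = hubʳ ; hubʳ = hubˡ ; leafˡ = leafʳ ; leafʳ = leafˡ
  ; missˡ = missʳ ; missʳ = missˡ ; missˡ≢missʳ = ≢-sym missˡ≢missʳ
  ; hubˡ-adj = hubʳ-adj ; hubʳ-adj = hubˡ-adj ; hubˡ-hubʳ = G-sym hubˡ-hubʳ
  ; leafˡ-adj = leafʳ-adj ; leafʳ-adj = leafˡ-adj
  ; leafˡ≢hubʳ = leafʳ≢hubˡ ; leafʳ≢hubˡ = leafˡ≢hubʳ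
  ; hubˡ∉clique = hubʳ∉clique ; hubʳ∉clique = hubˡ∉clique
  ; leafˡ∉clique = leafʳ∉clique ; leafʳ∉clique = leafˡ∉clique
  }
  where open TwoHubs H

module _ {n k m : ℕ} {G : Graph n} {col : Fin n → Fin k}
         (G-sym : Symmetric G) (star : StarColoring G k col) where

  private
    proper : Proper G col
    proper = proj₁ star

  hubˡCollides⇒colours : (H : TwoHubs G m) →
    col (TwoHubs.hubˡ H) ≡ col (TwoHubs.clique H (TwoHubs.missˡ H)) → 2 + m ≤ k
  hubˡCollides⇒colours H hubˡ≈miss =
    cliquePlusTwo⇒colours proper clique clique-adj leafˡ-avoids hubʳ-avoids leafˡ≉hubʳ
    where
    open TwoHubs H
    leafˡ-avoids : ∀ t → col leafˡ ≢ col (clique t)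
    leafˡ-avoids t with t ≟ᶠ missˡ
    ... | yes refl = λ e → proper _ _ leafˡ-adj (trans e (sym hubˡ≈miss))
    ... | no t≢miss = λ e → star⇒¬alternatingP4 star leafˡ-adj (hubˡ-adj t≢miss)
            (clique-adj t≢miss) (leafˡ∉clique t) (hubˡ∉clique missˡ) e hubˡ≈miss
    hubʳ-avoids : ∀ t → col hubʳ ≢ col (clique t)
    hubʳ-avoids t with t ≟ᶠ missʳ
    ... | yes refl = λ e → star⇒¬alternatingP4 star (G-sym hubˡ-hubʳ)
            (hubˡ-adj (≢-sym missˡ≢missʳ)) (clique-adj (≢-sym missˡ≢missʳ))
            (hubʳ∉clique missʳ) (hubˡ∉clique missˡ) e hubˡ≈miss
    ... | no t≢miss = proper _ _ (hubʳ-adj t≢miss)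
    leafˡ≉hubʳ : col leafˡ ≢ col hubʳ
    leafˡ≉hubʳ e = star⇒¬alternatingP4 star leafˡ-adj hubˡ-hubʳ (hubʳ-adj missˡ≢missʳ)
      leafˡ≢hubʳ (hubˡ∉clique missˡ) e hubˡ≈miss

  twoHubs⇒colours : TwoHubs G m → 2 + m ≤ k
  twoHubs⇒colours H with col (TwoHubs.hubˡ H) ≟ᶠ col (TwoHubs.clique H (TwoHubs.missˡ H))
                       | col (TwoHubs.hubʳ H) ≟ᶠ col (TwoHubs.clique H (TwoHubs.missʳ H))
  ... | yes hubˡ≈miss | _ = hubˡCollides⇒colours H hubˡ≈miss
  ... | no _ | yes hubʳ≈miss = hubˡCollides⇒colours (mirror G-sym H) hubʳ≈miss
  ... | no hubˡ≉miss | no hubʳ≉miss =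
    cliquePlusTwo⇒colours proper clique clique-adj (avoids hubˡ-adj hubˡ≉miss)
      (avoids hubʳ-adj hubʳ≉miss) (proper _ _ hubˡ-hubʳ)
    where
    open TwoHubs H
    avoids : ∀ {h miss} → (∀ {t} → t ≢ miss → G h (clique t)) →
      col h ≢ col (clique miss) → ∀ t → col h ≢ col (clique t)
    avoids {miss = miss} h-adj h≉miss t with t ≟ᶠ miss
    ... | yes refl = h≉miss
    ... | no t≢miss = proper _ _ (h-adj t≢miss)

Adj : ℕ → ℕ → ℕ → Set
Adj n x y = DBase n (suc x) (suc y) ⊎ DBase n (suc y) (suc x)

Adj-sym : ∀ {n x y} → Adj n x y → Adj n y x
Adj-sym (inj₁ e) = inj₂ e
Adj-sym (inj₂ e) = inj₁ e

Adj⇒D : ∀ {n} {u v : Fin n} {x y} → toℕ u ≡ x → toℕ v ≡ y → Adj n x y → D n u v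
Adj⇒D refl refl uv = uv

D-symmetric : ∀ n → Symmetric (D n)
D-symmetric n = Adj-sym

-- In D (4 + m), with 0-based indices, the clique is 0 … m − 1, the hubs are m
-- and 1 + m, and the leaves 2 + m and 3 + m hang off them.
hubᵃ-hubᵇ : ∀ {m} → Adj (4 + m) m (1 + m)
hubᵃ-hubᵇ = inj₂ (inj₂ (inj₂ (inj₂ (inj₁ (refl , refl)))))

leafᵃ-hubᵃ : ∀ {m} → Adj (4 + m) (2 + m) m
leafᵃ-hubᵃ = inj₁ (inj₂ (inj₂ (inj₂ (inj₂ (inj₁ (refl , refl))))))

leafᵇ-hubᵇ : ∀ {m} → Adj (4 + m) (3 + m) (1 + m)
leafᵇ-hubᵇ = inj₁ (inj₂ (inj₂ (inj₂ (inj₂ (inj₂ (refl , refl))))))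

D₅-lowerBound : ∀ j → j < 3 → (col : Fin 5 → Fin j) → ¬ StarColoring (D 5) j col
D₅-lowerBound j j<3 col star = <⇒≱ j<3
  (star∧P4⇒3≤colours star {# 3} {# 1} {# 2} {# 4}
    leafᵃ-hubᵃ hubᵃ-hubᵇ (Adj-sym leafᵇ-hubᵇ) (λ ()) (λ ()))

module UpperBound (k : ℕ) where

  data Kind : ℕ → Set where
    kept  : ∀ {x} → x < 3 + k → Kind x
    leafᵃ : Kind (3 + k)
    leafᵇ : Kind (4 + k)

  kind : ∀ {x} → x < 5 + k → Kind x
  kind {x} x<5+k with x ≟ 3 + k | x ≟ 4 + k
  ... | yes refl | _ = leafᵃ
  ... | no _ | yes refl = leafᵇ
  ... | no x≢3+k | no x≢4+k = kept (≤∧≢⇒< (≤-pred (≤∧≢⇒< (≤-pred x<5+k) x≢4+k)) x≢3+k)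

  colourOf : ∀ {x} → Kind x → Fin (3 + k)
  colourOf (kept x<3+k) = fromℕ< x<3+k
  colourOf leafᵃ = fromℕ (2 + k)
  colourOf leafᵇ = F.zero

  colour : Fin (5 + k) → Fin (3 + k)
  colour u = colourOf (kind (toℕ<n u))

  data Twins : ℕ → ℕ → Set where
    hubᵇ-leafᵃ : Twins (2 + k) (3 + k)
    leafᵃ-hubᵇ : Twins (3 + k) (2 + k)
    first-leafᵇ : Twins 0 (4 + k)
    leafᵇ-first : Twins (4 + k) 0

  Twins-sym : ∀ {x y} → Twins x y → Twins y x
  Twins-sym hubᵇ-leafᵃ = leafᵃ-hubᵇ
  Twins-sym leafᵃ-hubᵇ = hubᵇ-leafᵃ
  Twins-sym first-leafᵇ = leafᵇ-first
  Twins-sym leafᵇ-first = first-leafᵇ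

  sameColour⇒twins : ∀ {x y} (κ : Kind x) (κ′ : Kind y) →
    colourOf κ ≡ colourOf κ′ → x ≡ y ⊎ Twins x y
  sameColour⇒twins (kept p) (kept q) e = inj₁ (fromℕ<-injective _ _ p q e)
  sameColour⇒twins (kept p) leafᵃ e with trans (sym (toℕ-fromℕ< p)) (trans (cong toℕ e) (toℕ-fromℕ _))
  ... | refl = inj₂ hubᵇ-leafᵃ
  sameColour⇒twins (kept p) leafᵇ e with trans (sym (toℕ-fromℕ< p)) (cong toℕ e)
  ... | refl = inj₂ first-leafᵇ
  sameColour⇒twins leafᵃ (kept q) e with trans (sym (toℕ-fromℕ< q)) (trans (cong toℕ (sym e)) (toℕ-fromℕ _))
  ... | refl = inj₂ leafᵃ-hubᵇ
  sameColour⇒twins leafᵇ (kept q) e with trans (sym (toℕ-fromℕ< q)) (cong toℕ (sym e))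
  ... | refl = inj₂ leafᵇ-first
  sameColour⇒twins leafᵃ leafᵃ _ = inj₁ refl
  sameColour⇒twins leafᵇ leafᵇ _ = inj₁ refl
  sameColour⇒twins leafᵃ leafᵇ ()
  sameColour⇒twins leafᵇ leafᵃ ()

  twinEdge : ∀ {x x′ y y′} → Twins x x′ → Twins y y′ →
    DBase (5 + k) (suc x) (suc y) → x ≡ 4 + k × y ≡ 2 + k
  twinEdge first-leafᵇ first-leafᵇ (inj₁ (x≢y , _)) = ⊥-elim (x≢y refl)
  twinEdge first-leafᵇ hubᵇ-leafᵃ (inj₁ (_ , _ , _ , _ , y≤)) = ⊥-elim (m+n≮n 1 _ y≤)
  twinEdge first-leafᵇ leafᵃ-hubᵇ (inj₁ (_ , _ , _ , _ , y≤)) = ⊥-elim (m+n≮n 2 _ y≤)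
  twinEdge first-leafᵇ leafᵇ-first (inj₁ (_ , _ , _ , _ , y≤)) = ⊥-elim (m+n≮n 3 _ y≤)
  twinEdge hubᵇ-leafᵃ _ (inj₁ (_ , _ , x≤ , _)) = ⊥-elim (m+n≮n 1 _ x≤)
  twinEdge leafᵃ-hubᵇ _ (inj₁ (_ , _ , x≤ , _)) = ⊥-elim (m+n≮n 2 _ x≤)
  twinEdge leafᵇ-first _ (inj₁ (_ , _ , x≤ , _)) = ⊥-elim (m+n≮n 3 _ x≤)
  twinEdge _ first-leafᵇ (inj₂ (inj₂ (inj₁ (refl , s≤s () , _))))
  twinEdge _ hubᵇ-leafᵃ (inj₂ (inj₂ (inj₁ (refl , _ , y≤)))) = ⊥-elim (m+n≮n 1 _ y≤)
  twinEdge _ leafᵃ-hubᵇ (inj₂ (inj₂ (inj₁ (refl , _ , y≤)))) = ⊥-elim (m+n≮n 2 _ y≤)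
  twinEdge _ leafᵇ-first (inj₂ (inj₂ (inj₁ (refl , _ , y≤)))) = ⊥-elim (m+n≮n 3 _ y≤)
  twinEdge _ _ (inj₂ (inj₂ (inj₂ (inj₂ (inj₂ (refl , refl)))))) = refl , refl

  twinAdj : ∀ {x x′ y y′} → Twins x x′ → Twins y y′ → Adj (5 + k) x y →
    (x ≡ 4 + k × y ≡ 2 + k) ⊎ (y ≡ 4 + k × x ≡ 2 + k)
  twinAdj tx ty (inj₁ e) = inj₁ (twinEdge tx ty e)
  twinAdj tx ty (inj₂ e) = inj₂ (twinEdge ty tx e)

  twins-nonadjacent : ∀ {x y} → Twins x y → ¬ Adj (5 + k) x y
  twins-nonadjacent t e with twinAdj t (Twins-sym t) e
  twins-nonadjacent () e | inj₁ (refl , refl)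
  twins-nonadjacent () e | inj₂ (refl , refl)

  twinPath : ∀ {x x′ y y′ z z′} → Twins x x′ → Twins y y′ → Twins z z′ →
    Adj (5 + k) x y → Adj (5 + k) y z → x ≡ z
  twinPath tx ty tz xy yz with twinAdj tx ty xy | twinAdj ty tz yz
  ... | inj₁ (refl , refl) | inj₁ (() , _)
  ... | inj₁ (refl , refl) | inj₂ (refl , _) = refl
  ... | inj₂ (refl , refl) | inj₁ (_ , refl) = refl
  ... | inj₂ (refl , refl) | inj₂ (_ , ())

  Adj-irrefl : ∀ {x} → ¬ Adj (5 + k) x x
  Adj-irrefl (inj₁ e) = irrefl e
    where
    irrefl : ∀ {x} → ¬ DBase (5 + k) (suc x) (suc x)
    irrefl (inj₁ (x≢x , _)) = x≢x refl
    irrefl (inj₂ (inj₁ (refl , _ , x≤))) = m+n≮n 1 _ x≤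
    irrefl (inj₂ (inj₂ (inj₁ (refl , _ , x≤)))) = m+n≮n 1 _ x≤
    irrefl (inj₂ (inj₂ (inj₂ (inj₁ (refl , ())))))
    irrefl (inj₂ (inj₂ (inj₂ (inj₂ (inj₁ (refl , ()))))))
    irrefl (inj₂ (inj₂ (inj₂ (inj₂ (inj₂ (refl , ()))))))
  Adj-irrefl (inj₂ e) = Adj-irrefl (inj₁ e)

  colour-sameColour : ∀ u v → colour u ≡ colour v → toℕ u ≡ toℕ v ⊎ Twins (toℕ u) (toℕ v)
  colour-sameColour u v = sameColour⇒twins (kind (toℕ<n u)) (kind (toℕ<n v))

  colour-proper : Proper (D (5 + k)) colour
  colour-proper u v uv same with colour-sameColour u v same
  ... | inj₁ u≡v = Adj-irrefl (subst (Adj (5 + k) (toℕ u)) (sym u≡v) uv)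
  ... | inj₂ twins = twins-nonadjacent twins uv

  colour-star : StarColoring (D (5 + k)) (3 + k) colour
  colour-star = proper∧matching⇒star colour-proper (λ u → ∃[ x ] Twins (toℕ u) x)
    monochromatic⇒twins (λ (_ , tu) (_ , tv) (_ , tw) uv vw → toℕ-injective (twinPath tu tv tw uv vw))
    where
    monochromatic⇒twins : ∀ u v → u ≢ v → colour u ≡ colour v →
      (∃[ x ] Twins (toℕ u) x) × (∃[ y ] Twins (toℕ v) y)
    monochromatic⇒twins u v u≢v same with colour-sameColour u v same
    ... | inj₁ u≡v = ⊥-elim (u≢v (toℕ-injective u≡v))
    ... | inj₂ twins = (_ , twins) , (_ , Twins-sym twins)

module LowerBound (K : ℕ) where

  clique : Fin (2 + K) → Fin (6 + K)
  clique t = fromℕ< (clique< t)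
    where
    clique< : ∀ t → toℕ t < 6 + K
    clique< t = <-≤-trans (toℕ<n t) (m≤n+m (2 + K) 4)

  toℕ-clique : ∀ t → toℕ (clique t) ≡ toℕ t
  toℕ-clique t = toℕ-fromℕ< _

  outside : Fin 4 → Fin (6 + K)
  outside j = fromℕ< (+-monoˡ-< (2 + K) (toℕ<n j))

  toℕ-outside : ∀ j → toℕ (outside j) ≡ toℕ j + (2 + K)
  toℕ-outside j = toℕ-fromℕ< (+-monoˡ-< (2 + K) (toℕ<n j))

  outside-injective : ∀ {i j} → outside i ≡ outside j → i ≡ j
  outside-injective {i} {j} e = toℕ-injective (+-cancelʳ-≡ (2 + K) _ _
    (trans (sym (toℕ-outside i)) (trans (cong toℕ e) (toℕ-outside j))))

  outside∉clique : ∀ j t → outside j ≢ clique t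
  outside∉clique j t e = <⇒≢ (<-≤-trans (toℕ<n t) (m≤n+m _ (toℕ j)))
    (trans (sym (toℕ-clique t)) (trans (cong toℕ (sym e)) (toℕ-outside j)))

  last : Fin (2 + K)
  last = fromℕ (1 + K)

  ≢last⇒< : ∀ {t} → t ≢ last → toℕ t < 1 + K
  ≢last⇒< {t} t≢last =
    ≤∧≢⇒< (≤-pred (toℕ<n t)) (λ e → t≢last (toℕ-injective (trans e (sym (toℕ-fromℕ (1 + K))))))

  configuration : TwoHubs (D (6 + K)) (2 + K)
  configuration = record
    { clique = clique
    ; clique-adj = λ {s} {t} s≢t → Adj⇒D (toℕ-clique s) (toℕ-clique t) (inj₁ (inj₁
        ( (λ e → s≢t (toℕ-injective (suc-injective e)))
        , s≤s z≤n , toℕ<n s , s≤s z≤n , toℕ<n t )))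
    ; hubˡ = outside (# 0) ; hubʳ = outside (# 1) ; leafˡ = outside (# 2) ; leafʳ = outside (# 3)
    ; missˡ = last ; missʳ = F.zero ; missˡ≢missʳ = λ ()
    ; hubˡ-adj = λ {t} t≢last → Adj⇒D (toℕ-outside (# 0)) (toℕ-clique t)
        (inj₁ (inj₂ (inj₁ (refl , s≤s z≤n , ≢last⇒< t≢last))))
    ; hubʳ-adj = λ {t} t≢0 → Adj⇒D (toℕ-outside (# 1)) (toℕ-clique t)
        (inj₁ (inj₂ (inj₂ (inj₁ (refl , s≤s (n≢0⇒n>0 (t≢0 ∘ toℕ-injective)) , toℕ<n t)))))
    ; hubˡ-hubʳ = Adj⇒D (toℕ-outside (# 0)) (toℕ-outside (# 1)) hubᵃ-hubᵇ
    ; leafˡ-adj = Adj⇒D (toℕ-outside (# 2)) (toℕ-outside (# 0)) leafᵃ-hubᵃ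
    ; leafʳ-adj = Adj⇒D (toℕ-outside (# 3)) (toℕ-outside (# 1)) leafᵇ-hubᵇ
    ; leafˡ≢hubʳ = (λ ()) ∘ outside-injective {# 2} {# 1}
    ; leafʳ≢hubˡ = (λ ()) ∘ outside-injective {# 3} {# 0}
    ; hubˡ∉clique = outside∉clique (# 0)
    ; hubʳ∉clique = outside∉clique (# 1)
    ; leafˡ∉clique = outside∉clique (# 2)
    ; leafʳ∉clique = outside∉clique (# 3)
    }

  lowerBound : ∀ j → j < 4 + K → (col : Fin (6 + K) → Fin j) → ¬ StarColoring (D (6 + K)) j col
  lowerBound j j< col star = <⇒≱ j< (twoHubs⇒colours (D-symmetric (6 + K)) star configuration)

D-lowerBound : ∀ k j → j < 3 + k → (col : Fin (5 + k) → Fin j) → ¬ StarColoring (D (5 + k)) j col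
D-lowerBound zero = D₅-lowerBound
D-lowerBound (suc K) = LowerBound.lowerBound K

mainTheorem15 : (n : ℕ) → 5 ≤ n → StarChromaticNumber≡ (D n) (n ∸ 2)
mainTheorem15 _ (s≤s (s≤s (s≤s (s≤s (s≤s (z≤n {k})))))) =
  (UpperBound.colour k , UpperBound.colour-star k) , D-lowerBound k
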